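{- Let $L$ be a finite extremal congruence uniform lattice. Then every element of the spine of $L$ is a left modular element of $L$.
   Context: For a convex subset $C$ of a lattice $L$, $I_L(C)=\{y\mid\exists x\in C,y\le x\}$ and the doubling $L[C]$ is the subposet of $L\times\{0<1\}$ on $(I_L(C)\times\{0\})\sqcup\big(((L\setminus I_L(C))\cup C)\times\{1\}\big)$. A lattice is congruence uniform if it is obtained from the one-element lattice by a finite sequence of doublings of nonempty intervals. The length $\ell(L)$ is the maximum of $|F|-1$ over chains $F$; the spine is the set of elements lying on some chain of length $\ell(L)$. $L$ is extremal if $\ell(L)$ equals both the number of join-irreducible elements (elements covering exactly one element) and the number of meet-irreducible elements (elements covered by exactly one element). An element $a$ is left modular if for all $b<c$, $(b\vee a)\wedge c=b\vee(a\wedge c)$. -}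

module Defs where

open import Level using (0ℓ)
open import Data.Unit using (⊤; tt)
open import Data.Empty using (⊥)
open import Data.Bool using (Bool; true; false)
import Data.Bool as B
import Data.Bool.Properties as BP
open import Data.Nat using (ℕ; suc)
import Data.Nat
open import Data.Fin using (Fin)
open import Data.Product using (Σ; ∃; ∃-syntax; _×_; _,_; proj₁; proj₂)
open import Data.Sum using (_⊎_)
open import Data.List using (List; length)
open import Data.List.Membership.Setoid using () renaming (_∈_ to _∈ₛ_)
open import Data.List.Relation.Unary.Linked using (Linked)
open import Relation.Nullary using (¬_)
open import Relation.Binary using (Rel; Decidable)
open import Relation.Binary.Bundles using (Poset)
open import Relation.Binary.Lattice.Bundles using (Lattice)
open import Relation.Binary.Morphism.Structures using (IsOrderIsomorphism)
open import Relation.Binary.PropositionalEquality as P using (_≡_)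

OnePoset : Poset 0ℓ 0ℓ 0ℓ
OnePoset = record
  { Carrier = ⊤
  ; _≈_ = _≡_
  ; _≤_ = λ _ _ → ⊤
  ; isPartialOrder = record
    { isPreorder = record
      { isEquivalence = P.isEquivalence
      ; reflexive = λ _ → tt
      ; trans = λ _ _ → tt
      }
    ; antisym = λ _ _ → P.refl
    }
  }

-- I(C) = { y | ∃ x ∈ C, y ≤ x }
--   P[C] = (I(C) × {0}) ⊔ (((P ∖ I(C)) ∪ C) × {1})  ⊆  P × {0 < 1}
-- with the product order (0 = false, 1 = true, false ≤ true).

module _ (P : Poset 0ℓ 0ℓ 0ℓ) where
  open Poset P

  Downset : (Carrier → Set) → Carrier → Set
  Downset C y = ∃[ x ] (C x × y ≤ x)

  Interval : Carrier → Carrier → Carrier → Set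
  Interval a b x = a ≤ x × x ≤ b

  InDoubling : (Carrier → Set) → Carrier × Bool → Set
  InDoubling C (y , false) = Downset C y
  InDoubling C (y , true)  = (¬ Downset C y) ⊎ C y

  Doubling : (Carrier → Set) → Poset 0ℓ 0ℓ 0ℓ
  Doubling C = record
    { Carrier = Σ (Carrier × Bool) (InDoubling C)
    ; _≈_ = λ u v → (proj₁ (proj₁ u) ≈ proj₁ (proj₁ v)) × (proj₂ (proj₁ u) ≡ proj₂ (proj₁ v))
    ; _≤_ = λ u v → (proj₁ (proj₁ u) ≤ proj₁ (proj₁ v)) × (proj₂ (proj₁ u) B.≤ proj₂ (proj₁ v))
    ; isPartialOrder = record
      { isPreorder = record
        { isEquivalence = record
          { refl = Eq.refl , P.refl
          ; sym = λ (p , q) → Eq.sym p , P.sym q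
          ; trans = λ (p , q) (p' , q') → Eq.trans p p' , P.trans q q'
          }
        ; reflexive = λ (p , q) → reflexive p , BP.≤-reflexive q
        ; trans = λ (p , q) (p' , q') → trans p p' , BP.≤-trans q q'
        }
      ; antisym = λ (p , q) (p' , q') → antisym p p' , BP.≤-antisym q q'
      }
    }

data DoublingSequence : Poset 0ℓ 0ℓ 0ℓ → Set₁ where
  start  : DoublingSequence OnePoset
  double : ∀ {P} → DoublingSequence P →
           (a b : Poset.Carrier P) → Poset._≤_ P a b →
           DoublingSequence (Doubling P (Interval P a b))

_≅ₚ_ : Poset 0ℓ 0ℓ 0ℓ → Poset 0ℓ 0ℓ 0ℓ → Set
P ≅ₚ Q = ∃[ f ] IsOrderIsomorphism (Poset._≈_ P) (Poset._≈_ Q)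
                   (Poset._≤_ P) (Poset._≤_ Q) f

module _ (L : Lattice 0ℓ 0ℓ 0ℓ) where
  open Lattice L

  -- finite: the carrier (up to ≈) is enumerated by some Fin n;
  -- the order is decidable (automatic classically for finite lattices)
  Finite : Set
  Finite = (∃[ n ] Σ (Fin n → Carrier) (λ e → (x : Carrier) → ∃[ i ] (e i ≈ x)))
           × Decidable _≤_

  CongruenceUniform : Set₁
  CongruenceUniform = ∃[ P ] (DoublingSequence P × (poset ≅ₚ P))

  _<_ : Rel Carrier 0ℓ
  x < y = x ≤ y × ¬ (x ≈ y)

  _⋖_ : Rel Carrier 0ℓ
  x ⋖ y = x < y × (∀ z → x < z → ¬ (z < y))

  JoinIrreducible : Carrier → Set
  JoinIrreducible x = ∃[ y ] (y ⋖ x × (∀ z → z ⋖ x → z ≈ y))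

  MeetIrreducible : Carrier → Set
  MeetIrreducible x = ∃[ y ] (x ⋖ y × (∀ z → x ⋖ z → z ≈ y))

  HasCount : (Carrier → Set) → ℕ → Set
  HasCount Q k = Σ (Fin k → Carrier) λ e →
                   (∀ i → Q (e i))
                 × (∀ i j → e i ≈ e j → i ≡ j)
                 × (∀ x → Q x → ∃[ i ] (e i ≈ x))

  ChainOfLength : ℕ → List Carrier → Set
  ChainOfLength k F = length F ≡ suc k × Linked _<_ F

  IsLength : ℕ → Set
  IsLength k = (∃[ F ] ChainOfLength k F)
             × (∀ m F → ChainOfLength m F → m Data.Nat.≤ k)

  Extremal : Set
  Extremal = ∃[ k ] (IsLength k × HasCount JoinIrreducible k
                                 × HasCount MeetIrreducible k)

  InSpine : Carrier → Set
  InSpine x = ∃[ k ] (IsLength k × ∃[ F ] (ChainOfLength k F × _∈ₛ_ setoid x F))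

  LeftModular : Carrier → Set
  LeftModular a = ∀ b c → b < c → ((b ∨ a) ∧ c) ≈ (b ∨ (a ∧ c))

{-# OPTIONS --safe #-}
-- Congruence uniform lattices are meet-semidistributive: doubling an interval
-- preserves meet-semidistributivity, and it transfers along order isomorphisms.
-- On a maximal chain c₀ < ⋯ < cₙ of an extremal lattice choose, for each i, a
-- minimal Jᵢ ≤ cᵢ₊₁ with Jᵢ ≰ cᵢ; these are n distinct join-irreducibles, hence
-- all of them. Let b ≤ d and
-- y = b ∨ (c_k ∧ d). If (b ∨ c_k) ∧ d ≰ y, a minimal j ≤ (b ∨ c_k) ∧ d with j ≰ y
-- is some Jᵢ. For i < k it lies below c_k ∧ d ≤ y. For i ≥ k it is minimally
-- outside both y and cᵢ, so by meet-semidistributivity it is outside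
-- y ∨ cᵢ ≥ b ∨ c_k, again a contradiction.
module Submission where

open import Defs hiding (_<_)
open import Level using (0ℓ)
open import Function using (_∘_; _on_; mk⇔)
open import Function.Definitions using (Injective)
open import Data.Bool as B using (Bool; true; false)
open import Data.Bool.Properties as BP using (≤-minimum; ≤-maximum)
open import Data.Empty using (⊥; ⊥-elim)
open import Data.Unit using (tt)
open import Data.Product using (∃-syntax; _×_; _,_; proj₁; proj₂)
open import Data.Sum using (inj₁; inj₂; [_,_]′)
open import Data.Nat as ℕ using (suc)
import Data.Nat.Properties as ℕ
open import Data.Fin as Fin using (Fin; toℕ; inject₁; cast; punchOut)
import Data.Fin.Properties as Finₚ
open Finₚ using (any?; toℕ-inject₁; toℕ-cast; cast-involutive; ≤̄⇒inject₁<; ≤∧≢⇒<; punchOut-injective; injective⇒≤)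
open import Data.Fin.Induction using (po-wellFounded)
open import Data.List using (List; length; lookup)
open import Data.List.Relation.Unary.Linked as Linked using (Linked; [-]; _∷_)
open import Data.List.Relation.Unary.Any using (index)
open import Data.List.Relation.Unary.Any.Properties using (lookup-index)
open import Data.List.Membership.Setoid using () renaming (_∈_ to _∈ₛ_)
open import Data.Maybe.Relation.Binary.Connected using (just)
open import Induction.WellFounded using (WellFounded; Acc; acc)
open import Relation.Nullary using (¬_; Dec; yes; no; does; contradiction)
open import Relation.Nullary.Decidable using (map′; ¬?; _×-dec_; _⊎-dec_; decidable-stable; dec-true; does-⇔)
open import Relation.Binary using (Rel; Decidable; Transitive; _Respects_; _Preserves_⟶_; tri<; tri≈; tri>)
open import Relation.Binary.Bundles using (Poset)
open import Relation.Binary.Structures using (IsStrictPartialOrder)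
open import Relation.Binary.Lattice using (Supremum; Infimum)
open import Relation.Binary.Lattice.Bundles using (Lattice)
open import Relation.Binary.Morphism.Structures using (IsOrderIsomorphism)
import Relation.Binary.Construct.On as On
import Relation.Binary.Construct.NonStrictToStrict as ToStrict
import Relation.Binary.Properties.Poset as PosetProperties
import Relation.Binary.Lattice.Properties.JoinSemilattice as JoinSemilatticeProperties
import Relation.Binary.Lattice.Properties.MeetSemilattice as MeetSemilatticeProperties
import Relation.Binary.Reasoning.PartialOrder as ≤-Reasoning
import Relation.Binary.Reasoning.Setoid as ≈-Reasoning
open import Relation.Binary.PropositionalEquality as ≡ using (_≡_; _≢_)
open import Algebra.Core using (Op₂)

MeetSemidistributive : {A : Set} → Rel A 0ℓ → Op₂ A → Op₂ A → Set
MeetSemidistributive _≈_ _∨_ _∧_ =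
  ∀ x y z → (x ∧ z) ≈ (y ∧ z) → ((x ∨ y) ∧ z) ≈ (x ∧ z)

record DecMeetSemidistributiveLattice (P : Poset 0ℓ 0ℓ 0ℓ) : Set where
  open Poset P
  field
    _∨_ _∧_              : Op₂ Carrier
    supremum             : Supremum _≤_ _∨_
    infimum              : Infimum _≤_ _∧_
    _≤?_                 : Decidable _≤_
    meetSemidistributive : MeetSemidistributive _≈_ _∨_ _∧_

  lattice : Lattice 0ℓ 0ℓ 0ℓ
  lattice = record
    { isLattice = record
      { isPartialOrder = isPartialOrder ; supremum = supremum ; infimum = infimum } }

Bool-∨-supremum : Supremum B._≤_ B._∨_
Bool-∨-supremum false y = ≤-minimum y , BP.≤-refl , λ _ _ y≤z → y≤z
Bool-∨-supremum true  y = BP.≤-refl , ≤-maximum y , λ _ t≤z _ → t≤z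

Bool-∧-infimum : Infimum B._≤_ B._∧_
Bool-∧-infimum false y = BP.≤-refl , ≤-minimum y , λ _ z≤f _ → z≤f
Bool-∧-infimum true  y = ≤-maximum y , BP.≤-refl , λ _ _ z≤y → z≤y

Bool-meetSemidistributive : MeetSemidistributive _≡_ B._∨_ B._∧_
Bool-meetSemidistributive x y z xz≡yz = begin
  (x B.∨ y) B.∧ z          ≡⟨ BP.∧-distribʳ-∨ z x y ⟩
  (x B.∧ z) B.∨ (y B.∧ z)  ≡⟨ ≡.cong ((x B.∧ z) B.∨_) (≡.sym xz≡yz) ⟩
  (x B.∧ z) B.∨ (x B.∧ z)  ≡⟨ BP.∨-idem (x B.∧ z) ⟩
  x B.∧ z                  ∎
  where open ≡.≡-Reasoning

onePoint-msLattice : DecMeetSemidistributiveLattice OnePoset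
onePoint-msLattice = record
  { _∨_ = λ _ _ → tt ; _∧_ = λ _ _ → tt
  ; supremum = λ _ _ → tt , tt , λ _ _ _ → tt
  ; infimum = λ _ _ → tt , tt , λ _ _ _ → tt
  ; _≤?_ = λ _ _ → yes tt
  ; meetSemidistributive = λ _ _ _ _ → ≡.refl
  }

module _ {P : Poset 0ℓ 0ℓ 0ℓ} (S : DecMeetSemidistributiveLattice P)
         {a b : Poset.Carrier P} (a≤b : Poset._≤_ P a b) where
  open Poset P
  open DecMeetSemidistributiveLattice S
  open Lattice lattice using (x≤x∨y; y≤x∨y; ∨-least; x∧y≤x; x∧y≤y)

  private
    C : Carrier → Set
    C = Interval P a b

    D : Poset 0ℓ 0ℓ 0ℓ
    D = Doubling P C

  downset⇒≤ : ∀ {w} → Downset P C w → w ≤ b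
  downset⇒≤ (_ , (_ , x≤b) , w≤x) = trans w≤x x≤b

  ≤⇒downset : ∀ {w} → w ≤ b → Downset P C w
  ≤⇒downset w≤b = b , (a≤b , refl) , w≤b

  downset-downward : ∀ {v w} → Downset P C w → v ≤ w → Downset P C v
  downset-downward (x , x∈C , w≤x) v≤w = x , x∈C , trans v≤w w≤x

  Top : Carrier → Set
  Top w = InDoubling P C (w , true)

  top-upward : ∀ {v w} → Top v → v ≤ w → Top w
  top-upward {v} {w} v∈Top v≤w with w ≤? b | v∈Top
  ... | no w≰b  | _               = inj₁ (w≰b ∘ downset⇒≤)
  ... | yes w≤b | inj₁ v∉downset  = ⊥-elim (v∉downset (≤⇒downset (trans v≤w w≤b)))
  ... | yes w≤b | inj₂ (a≤v , _)  = inj₂ (trans a≤v v≤w , w≤b)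

  downset? : ∀ w → Dec (Downset P C w)
  downset? w = map′ ≤⇒downset downset⇒≤ (w ≤? b)

  top? : ∀ w → Dec (Top w)
  top? w = ¬? (downset? w) ⊎-dec (a ≤? w ×-dec w ≤? b)

  inTop : Carrier → Bool
  inTop w = does (top? w)

  decided-member : ∀ {w} (w∈Top? : Dec (Top w)) → InDoubling P C (w , does w∈Top?)
  decided-member     (yes w∈Top) = w∈Top
  decided-member {w} (no  w∉Top) = decidable-stable (downset? w) (w∉Top ∘ inj₁)

  inTop-cong : ∀ {v w} → v ≈ w → inTop v ≡ inTop w
  inTop-cong v≈w = does-⇔
    (mk⇔ (λ t → top-upward t (reflexive v≈w)) (λ t → top-upward t (reflexive (Eq.sym v≈w))))
    (top? _) (top? _)

  ≤-inTop : ∀ {v γ w} → InDoubling P C (v , γ) → v ≤ w → γ B.≤ inTop w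
  ≤-inTop {γ = false} _    _   = ≤-minimum _
  ≤-inTop {γ = true}  v∈Top v≤w = BP.≤-reflexive (≡.sym (dec-true (top? _) (top-upward v∈Top v≤w)))

  ∨-member : ∀ {p α q β} → InDoubling P C (p , α) → InDoubling P C (q , β) →
             InDoubling P C (p ∨ q , α B.∨ β)
  ∨-member {α = false} {β = false} p∈ q∈ = ≤⇒downset (∨-least (downset⇒≤ p∈) (downset⇒≤ q∈))
  ∨-member {α = false} {β = true}  _  q∈ = top-upward q∈ (y≤x∨y _ _)
  ∨-member {α = true}              p∈ _  = top-upward p∈ (x≤x∨y _ _)

  ∧-member : ∀ {p α q β} → InDoubling P C (p , α) → InDoubling P C (q , β) →
             InDoubling P C (p ∧ q , α B.∧ (β B.∧ inTop (p ∧ q)))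
  ∧-member {α = false}             p∈ _  = downset-downward p∈ (x∧y≤x _ _)
  ∧-member {α = true} {β = false}  _  q∈ = downset-downward q∈ (x∧y≤y _ _)
  ∧-member {α = true} {β = true}   _  _  = decided-member (top? _)

  private
    module D = Poset D

  -- In the meet, the top copy survives only if p ∧ q still lies in it.
  _⊔_ _⊓_ : Op₂ D.Carrier
  ((p , α) , p∈) ⊔ ((q , β) , q∈) = (p ∨ q , α B.∨ β) , ∨-member p∈ q∈
  ((p , α) , p∈) ⊓ ((q , β) , q∈) = (p ∧ q , α B.∧ (β B.∧ inTop (p ∧ q))) , ∧-member p∈ q∈

  ⊔-supremum : Supremum D._≤_ _⊔_
  ⊔-supremum ((p , α) , _) ((q , β) , _) =
    let p≤ , q≤ , least = supremum p q
        α≤ , β≤ , least′ = Bool-∨-supremum α β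
    in (p≤ , α≤) , (q≤ , β≤) ,
       λ _ (p≤r , α≤γ) (q≤r , β≤γ) → least _ p≤r q≤r , least′ _ α≤γ β≤γ

  ⊓-infimum : Infimum D._≤_ _⊓_
  ⊓-infimum ((p , α) , _) ((q , β) , _) =
    let ≤p , ≤q , greatest = infimum p q
        ≤α , ≤β∧t , greatest′ = Bool-∧-infimum α (β B.∧ inTop (p ∧ q))
        ≤β , _ , greatest″ = Bool-∧-infimum β (inTop (p ∧ q))
    in (≤p , ≤α) , (≤q , BP.≤-trans ≤β∧t ≤β) ,
       λ { ((r , γ) , r∈) (r≤p , γ≤α) (r≤q , γ≤β) →
             let r≤p∧q = greatest r r≤p r≤q
             in r≤p∧q , greatest′ γ γ≤α (greatest″ γ γ≤β (≤-inTop r∈ r≤p∧q)) }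

  ⊓-⊔-meetSemidistributive : MeetSemidistributive D._≈_ _⊔_ _⊓_
  ⊓-⊔-meetSemidistributive ((p , α) , _) ((q , β) , _) ((r , γ) , _) (pr≈qr , αγ≡βγ) =
    [p∨q]∧r≈p∧r , (begin
      (α B.∨ β) B.∧ (γ B.∧ inTop ((p ∨ q) ∧ r))
        ≡⟨ ≡.cong (λ t → (α B.∨ β) B.∧ (γ B.∧ t)) (inTop-cong [p∨q]∧r≈p∧r) ⟩
      (α B.∨ β) B.∧ (γ B.∧ inTop (p ∧ r))
        ≡⟨ Bool-meetSemidistributive α β _
             (≡.trans αγ≡βγ (≡.cong (λ t → β B.∧ (γ B.∧ t)) (inTop-cong (Eq.sym pr≈qr)))) ⟩
      α B.∧ (γ B.∧ inTop (p ∧ r)) ∎)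
    where
    open ≡.≡-Reasoning
    [p∨q]∧r≈p∧r : ((p ∨ q) ∧ r) ≈ (p ∧ r)
    [p∨q]∧r≈p∧r = meetSemidistributive p q r pr≈qr

  doubling-msLattice : DecMeetSemidistributiveLattice D
  doubling-msLattice = record
    { _∨_ = _⊔_ ; _∧_ = _⊓_
    ; supremum = ⊔-supremum
    ; infimum = ⊓-infimum
    ; _≤?_ = λ { ((p , α) , _) ((q , β) , _) → p ≤? q ×-dec α BP.≤? β }
    ; meetSemidistributive = ⊓-⊔-meetSemidistributive
    }

doublingSequence-msLattice : ∀ {P} → DoublingSequence P → DecMeetSemidistributiveLattice P
doublingSequence-msLattice start              = onePoint-msLattice
doublingSequence-msLattice (double s _ _ a≤b) = doubling-msLattice (doublingSequence-msLattice s) a≤b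

module OrderIsomorphism {L M : Lattice 0ℓ 0ℓ 0ℓ} {f : Lattice.Carrier L → Lattice.Carrier M}
  (iso : IsOrderIsomorphism (Lattice._≈_ L) (Lattice._≈_ M) (Lattice._≤_ L) (Lattice._≤_ M) f)
  where
  private
    module M = Lattice M
  open Lattice L
  open MeetSemilatticeProperties M.meetSemilattice using (∧-cong)
  open IsOrderIsomorphism iso

  preimage : ∀ v → ∃[ u ] (f u M.≈ v)
  preimage v = let u , f-onto = surjective v in u , f-onto Eq.refl

  ∧-homo : ∀ x y → f (x ∧ y) M.≈ (f x M.∧ f y)
  ∧-homo x y = M.antisym
    (M.∧-greatest (mono (x∧y≤x x y)) (mono (x∧y≤y x y)))
    (M.≤-respˡ-≈ fl≈ (mono (∧-greatest (cancel (M.≤-respˡ-≈ (M.Eq.sym fl≈) (M.x∧y≤x _ _)))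
                                       (cancel (M.≤-respˡ-≈ (M.Eq.sym fl≈) (M.x∧y≤y _ _))))))
    where
    l : Carrier
    l = proj₁ (preimage (f x M.∧ f y))
    fl≈ : f l M.≈ (f x M.∧ f y)
    fl≈ = proj₂ (preimage (f x M.∧ f y))

  ∨-homo : ∀ x y → f (x ∨ y) M.≈ (f x M.∨ f y)
  ∨-homo x y = M.antisym
    (M.≤-respʳ-≈ fu≈ (mono (∨-least (cancel (M.≤-respʳ-≈ (M.Eq.sym fu≈) (M.x≤x∨y _ _)))
                                    (cancel (M.≤-respʳ-≈ (M.Eq.sym fu≈) (M.y≤x∨y _ _))))))
    (M.∨-least (mono (x≤x∨y x y)) (mono (y≤x∨y x y)))
    where
    u : Carrier
    u = proj₁ (preimage (f x M.∨ f y))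
    fu≈ : f u M.≈ (f x M.∨ f y)
    fu≈ = proj₂ (preimage (f x M.∨ f y))

  meetSemidistributive : MeetSemidistributive M._≈_ M._∨_ M._∧_ →
                         MeetSemidistributive _≈_ _∨_ _∧_
  meetSemidistributive msd x y z xz≈yz = injective (begin
    f ((x ∨ y) ∧ z)         ≈⟨ ∧-homo (x ∨ y) z ⟩
    f (x ∨ y) M.∧ f z       ≈⟨ ∧-cong (∨-homo x y) M.Eq.refl ⟩
    (f x M.∨ f y) M.∧ f z   ≈⟨ msd (f x) (f y) (f z) fxz≈fyz ⟩
    f x M.∧ f z             ≈⟨ ∧-homo x z ⟨
    f (x ∧ z)               ∎)
    where
    open ≈-Reasoning M.setoid
    fxz≈fyz : (f x M.∧ f z) M.≈ (f y M.∧ f z)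
    fxz≈fyz = M.Eq.trans (M.Eq.sym (∧-homo x z)) (M.Eq.trans (cong xz≈yz) (∧-homo y z))

congruenceUniform⇒meetSemidistributive : ∀ L → CongruenceUniform L →
  MeetSemidistributive (Lattice._≈_ L) (Lattice._∨_ L) (Lattice._∧_ L)
congruenceUniform⇒meetSemidistributive L (_ , s , _ , iso) =
  OrderIsomorphism.meetSemidistributive {L = L} {M = lattice} iso meetSemidistributive
  where open DecMeetSemidistributiveLattice (doublingSequence-msLattice s)

Linked-lookup⁺ : ∀ {A : Set} {R : Rel A 0ℓ} → Transitive R → ∀ {xs} → Linked R xs →
                 ∀ {i j} → i Fin.< j → R (lookup xs i) (lookup xs j)
Linked-lookup⁺ R-trans (r ∷ rs) {Fin.zero}  {Fin.suc j} _   = Linked.lookup R-trans rs (just r) j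
Linked-lookup⁺ R-trans (_ ∷ rs) {Fin.suc i} {Fin.suc j} i<j = Linked-lookup⁺ R-trans rs (ℕ.s<s⁻¹ i<j)
Linked-lookup⁺ R-trans [-]      {Fin.zero}  {Fin.suc ()}

Fin-injective⇒surjective : ∀ {n} (f : Fin n → Fin n) → Injective _≡_ _≡_ f → ∀ p → ∃[ i ] (f i ≡ p)
Fin-injective⇒surjective {suc n} f f-injective p with any? (λ i → f i Finₚ.≟ p)
... | yes hit  = hit
... | no  miss = contradiction (injective⇒≤ punched-injective) ℕ.1+n≰n
  where
  p≢f : ∀ i → p ≢ f i
  p≢f i p≡fi = miss (i , ≡.sym p≡fi)
  punched : Fin (suc n) → Fin n
  punched i = punchOut (p≢f i)
  punched-injective : Injective _≡_ _≡_ punched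
  punched-injective eq = f-injective (punchOut-injective (p≢f _) (p≢f _) eq)

module _ (L : Lattice 0ℓ 0ℓ 0ℓ) where
  open Lattice L
  open PosetProperties poset using (_<_; <⇒≱; <-isStrictPartialOrder; ≤-dec⇒≈-dec)
  open IsStrictPartialOrder <-isStrictPartialOrder using (<-respˡ-≈; <-respʳ-≈) renaming (trans to <-trans)
  open JoinSemilatticeProperties joinSemilattice using (∨-cong)
  open MeetSemilatticeProperties meetSemilattice using (∧-cong)
  open ≤-Reasoning poset

  isLength-unique : ∀ {m n} → IsLength L m → IsLength L n → m ≡ n
  isLength-unique ((F , F-chain) , m-max) ((G , G-chain) , n-max) =
    ℕ.≤-antisym (n-max _ F F-chain) (m-max _ G G-chain)

  modular-≤ : ∀ {x b d} → b ≤ d → b ∨ (x ∧ d) ≤ (b ∨ x) ∧ d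
  modular-≤ {x} {b} {d} b≤d =
    ∨-least (∧-greatest (x≤x∨y b x) b≤d)
            (∧-greatest (trans (x∧y≤x x d) (y≤x∨y b x)) (x∧y≤y x d))

  leftModular-resp : ∀ {x x′} → x ≈ x′ → LeftModular L x → LeftModular L x′
  leftModular-resp {x} {x′} x≈x′ x-modular b d b<d = begin-equality
    (b ∨ x′) ∧ d   ≈⟨ ∧-cong (∨-cong Eq.refl (Eq.sym x≈x′)) Eq.refl ⟩
    (b ∨ x) ∧ d    ≈⟨ x-modular b d b<d ⟩
    b ∨ (x ∧ d)    ≈⟨ ∨-cong Eq.refl (∧-cong x≈x′ Eq.refl) ⟩
    b ∨ (x′ ∧ d)   ∎

  injective-family-covers : ∀ {P n} → HasCount L P n →
    (J : Fin n → Carrier) → (∀ i → P (J i)) → (∀ {i i′} → J i ≈ J i′ → i ≡ i′) →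
    ∀ {w} → P w → ∃[ i ] (J i ≈ w)
  injective-family-covers {P} {n} (e , _ , _ , e-onto) J J-in-P J-injective {w} w-in-P =
    let p , eₚ≈w = e-onto w w-in-P
        i , gᵢ≡p = Fin-injective⇒surjective g g-injective p
    in i , Eq.trans (Eq.sym (g-spec i)) (Eq.trans (Eq.reflexive (≡.cong e gᵢ≡p)) eₚ≈w)
    where
    g : Fin n → Fin n
    g i = proj₁ (e-onto (J i) (J-in-P i))
    g-spec : ∀ i → e (g i) ≈ J i
    g-spec i = proj₂ (e-onto (J i) (J-in-P i))
    g-injective : Injective _≡_ _≡_ g
    g-injective {i} {i′} gᵢ≡gᵢ′ =
      J-injective (Eq.trans (Eq.sym (g-spec i)) (Eq.trans (Eq.reflexive (≡.cong e gᵢ≡gᵢ′)) (g-spec i′)))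

  MinimalNotBelow : Carrier → Carrier → Set
  MinimalNotBelow y j = ¬ j ≤ y × (∀ {w} → w < j → w ≤ y)

  minimalNotBelow-resp : ∀ {y j j′} → j ≈ j′ → MinimalNotBelow y j → MinimalNotBelow y j′
  minimalNotBelow-resp j≈j′ (j≰y , below) =
    (λ j′≤y → j≰y (trans (reflexive j≈j′) j′≤y)) , λ w<j′ → below (<-respʳ-≈ (Eq.sym j≈j′) w<j′)

  ≰⇒∧< : ∀ {j y} → ¬ j ≤ y → y ∧ j < j
  ≰⇒∧< {j} {y} j≰y = x∧y≤y y j , λ y∧j≈j → j≰y (trans (reflexive (Eq.sym y∧j≈j)) (x∧y≤x y j))

  minimalNotBelow-joinIrreducible : Decidable _≈_ → ∀ {y j} → MinimalNotBelow y j → JoinIrreducible L j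
  minimalNotBelow-joinIrreducible _≈?_ {y} {j} (j≰y , below) = y ∧ j , (y∧j<j , nothing-between) , unique
    where
    y∧j<j : y ∧ j < j
    y∧j<j = ≰⇒∧< j≰y
    <⇒≤y∧j : ∀ {w} → w < j → w ≤ y ∧ j
    <⇒≤y∧j w<j = ∧-greatest (below w<j) (proj₁ w<j)
    nothing-between : ∀ z → y ∧ j < z → ¬ z < j
    nothing-between z y∧j<z z<j = <⇒≱ y∧j<z (<⇒≤y∧j z<j)
    unique : ∀ z → _⋖_ L z j → z ≈ y ∧ j
    unique z (z<j , z-covered) = decidable-stable (z ≈? (y ∧ j))
      λ z≉y∧j → z-covered (y ∧ j) (<⇒≤y∧j z<j , z≉y∧j) y∧j<j

  -- Both y ∧ j and u ∧ j are the unique lower cover of j.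
  minimalNotBelow-join : MeetSemidistributive _≈_ _∨_ _∧_ → ∀ {y u j} →
    MinimalNotBelow y j → MinimalNotBelow u j → ¬ j ≤ y ∨ u
  minimalNotBelow-join msd {y} {u} {j} (j≰y , below-y) (j≰u , below-u) j≤y∨u = j≰y (begin
    j             ≤⟨ ∧-greatest j≤y∨u refl ⟩
    (y ∨ u) ∧ j   ≈⟨ msd y u j y∧j≈u∧j ⟩
    y ∧ j         ≤⟨ x∧y≤x y j ⟩
    y             ∎)
    where
    y∧j≈u∧j : y ∧ j ≈ u ∧ j
    y∧j≈u∧j = antisym (∧-greatest (below-u (≰⇒∧< j≰y)) (x∧y≤y y j))
                      (∧-greatest (below-y (≰⇒∧< j≰u)) (x∧y≤y u j))

  Minimal : (Carrier → Set) → Carrier → Set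
  Minimal P m = P m × (∀ {w} → w < m → ¬ P w)

  minimal-below : Finite L → ∀ {P} → (∀ x → Dec (P x)) → P Respects _≈_ →
                  ∀ {x} → P x → ∃[ m ] (m ≤ x × Minimal P m)
  minimal-below ((_ , enum , enum-onto) , _≤?_) {P} P? P-resp {x} px =
    let i , eᵢ≈x = enum-onto x
        m , m≤eᵢ , m-minimal = search i (⊏-wellFounded i) (P-resp (Eq.sym eᵢ≈x) px)
    in m , trans m≤eᵢ (reflexive eᵢ≈x) , m-minimal
    where
    _<?_ : Decidable _<_
    _<?_ = ToStrict.<-decidable _≈_ _≤_ (≤-dec⇒≈-dec _≤?_) _≤?_
    ⊏-wellFounded : WellFounded (_<_ on enum)
    ⊏-wellFounded = po-wellFounded (On.isPartialOrder enum isPartialOrder)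
    search : ∀ i → Acc (_<_ on enum) i → P (enum i) → ∃[ m ] (m ≤ enum i × Minimal P m)
    search i (acc smaller) pᵢ with any? (λ j → P? (enum j) ×-dec enum j <? enum i)
    ... | yes (j , pⱼ , eⱼ<eᵢ) =
      let m , m≤eⱼ , m-minimal = search j (smaller eⱼ<eᵢ) pⱼ
      in m , trans m≤eⱼ (proj₁ eⱼ<eᵢ) , m-minimal
    ... | no none = enum i , refl , pᵢ , λ {w} w<eᵢ pw →
      let j , eⱼ≈w = enum-onto w
      in none (j , P-resp (Eq.sym eⱼ≈w) pw , <-respˡ-≈ (Eq.sym eⱼ≈w) w<eᵢ)

  minimalNotBelow-below : Finite L → ∀ {x y} → ¬ x ≤ y → ∃[ j ] (j ≤ x × MinimalNotBelow y j)
  minimalNotBelow-below fin {x} {y} x≰y =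
    let j , j≤x , j≰y , minimal = minimal-below fin (λ w → ¬? (w ≤? y)) ≰-resp x≰y
    in j , j≤x , j≰y , λ w<j → decidable-stable (_ ≤? y) (minimal w<j)
    where
    _≤?_ : Decidable _≤_
    _≤?_ = proj₂ fin
    ≰-resp : (λ w → ¬ w ≤ y) Respects _≈_
    ≰-resp w≈w′ w≰y w′≤y = w≰y (trans (reflexive w≈w′) w′≤y)

  module _ (F : List Carrier) {n} (length≡ : length F ≡ suc n) where

    chainAt : Fin (suc n) → Carrier
    chainAt = lookup F ∘ cast (≡.sym length≡)

    chainAt-increasing : Linked _<_ F → chainAt Preserves Fin._<_ ⟶ _<_
    chainAt-increasing F-chain {i} {j} i<j = Linked-lookup⁺ <-trans F-chain
      (≡.subst₂ ℕ._<_ (≡.sym (toℕ-cast _ i)) (≡.sym (toℕ-cast _ j)) i<j)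

    ∈⇒chainAt : ∀ {x} → _∈ₛ_ setoid x F → ∃[ k ] (x ≈ chainAt k)
    ∈⇒chainAt x∈F = cast length≡ (index x∈F) ,
      Eq.trans (lookup-index x∈F)
        (Eq.reflexive (≡.cong (lookup F) (≡.sym (cast-involutive _ length≡ (index x∈F)))))

  module Chain (fin : Finite L) (msd : MeetSemidistributive _≈_ _∨_ _∧_)
               {n} (#joinIrreducibles : HasCount L (JoinIrreducible L) n)
               (c : Fin (suc n) → Carrier) (c-increasing : c Preserves Fin._<_ ⟶ _<_) where

    private
      _≤?_ : Decidable _≤_
      _≤?_ = proj₂ fin

    c-monotone : ∀ {i j} → i Fin.≤ j → c i ≤ c j
    c-monotone {i} {j} i≤j with i Finₚ.≟ j
    ... | yes ≡.refl = refl
    ... | no  i≢j    = proj₁ (c-increasing (≤∧≢⇒< i≤j i≢j))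

    c-monotone-inject₁ : ∀ {k i} → toℕ k ℕ.≤ toℕ i → c k ≤ c (inject₁ i)
    c-monotone-inject₁ {i = i} k≤i = c-monotone (ℕ.≤-trans k≤i (ℕ.≤-reflexive (≡.sym (toℕ-inject₁ i))))

    c-step : ∀ i → ¬ c (Fin.suc i) ≤ c (inject₁ i)
    c-step i = <⇒≱ (c-increasing (≤̄⇒inject₁< Finₚ.≤-refl))

    private
      J-spec : ∀ i → ∃[ j ] (j ≤ c (Fin.suc i) × MinimalNotBelow (c (inject₁ i)) j)
      J-spec i = minimalNotBelow-below fin (c-step i)

    J : Fin n → Carrier
    J i = proj₁ (J-spec i)

    J≤c : ∀ i → J i ≤ c (Fin.suc i)
    J≤c i = proj₁ (proj₂ (J-spec i))

    J-minimal : ∀ i → MinimalNotBelow (c (inject₁ i)) (J i)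
    J-minimal i = proj₂ (proj₂ (J-spec i))

    J-joinIrreducible : ∀ i → JoinIrreducible L (J i)
    J-joinIrreducible i = minimalNotBelow-joinIrreducible (≤-dec⇒≈-dec _≤?_) (J-minimal i)

    J-separated : ∀ {i i′} → i Fin.< i′ → ¬ J i ≈ J i′
    J-separated {i} {i′} i<i′ Jᵢ≈Jᵢ′ = proj₁ (J-minimal i′) (begin
      J i′                ≈⟨ Eq.sym Jᵢ≈Jᵢ′ ⟩
      J i                 ≤⟨ J≤c i ⟩
      c (Fin.suc i)       ≤⟨ c-monotone-inject₁ i<i′ ⟩
      c (inject₁ i′)      ∎)

    J-injective : ∀ {i i′} → J i ≈ J i′ → i ≡ i′
    J-injective {i} {i′} Jᵢ≈Jᵢ′ with Finₚ.<-cmp i i′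
    ... | tri< i<i′ _ _ = contradiction Jᵢ≈Jᵢ′ (J-separated i<i′)
    ... | tri≈ _ i≡i′ _ = i≡i′
    ... | tri> _ _ i′<i = contradiction (Eq.sym Jᵢ≈Jᵢ′) (J-separated i′<i)

    J-covers : ∀ {w} → JoinIrreducible L w → ∃[ i ] (J i ≈ w)
    J-covers = injective-family-covers #joinIrreducibles J J-joinIrreducible J-injective

    no-minimalNotBelow-in-modularGap : ∀ k {b d j} → j ≤ (b ∨ c k) ∧ d →
                                       ¬ MinimalNotBelow (b ∨ (c k ∧ d)) j
    no-minimalNotBelow-in-modularGap k {b} {d} {j} j≤lhs j-minimal =
      let i , Jᵢ≈j = J-covers (minimalNotBelow-joinIrreducible (≤-dec⇒≈-dec _≤?_) j-minimal)
      in [ at-or-above i Jᵢ≈j , below i Jᵢ≈j ]′ (ℕ.≤-<-connex (toℕ k) (toℕ i))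
      where
      below : ∀ i → J i ≈ j → toℕ i ℕ.< toℕ k → ⊥
      below i Jᵢ≈j i<k = proj₁ j-minimal (begin
        j              ≤⟨ ∧-greatest j≤cₖ (trans j≤lhs (x∧y≤y _ d)) ⟩
        c k ∧ d        ≤⟨ y≤x∨y b _ ⟩
        b ∨ (c k ∧ d)  ∎)
        where
        j≤cₖ : j ≤ c k
        j≤cₖ = begin
          j              ≈⟨ Eq.sym Jᵢ≈j ⟩
          J i            ≤⟨ J≤c i ⟩
          c (Fin.suc i)  ≤⟨ c-monotone i<k ⟩
          c k            ∎
      at-or-above : ∀ i → J i ≈ j → toℕ k ℕ.≤ toℕ i → ⊥
      at-or-above i Jᵢ≈j k≤i = minimalNotBelow-join msd j-minimal
        (minimalNotBelow-resp Jᵢ≈j (J-minimal i)) (begin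
        j                               ≤⟨ j≤lhs ⟩
        (b ∨ c k) ∧ d                   ≤⟨ x∧y≤x _ d ⟩
        b ∨ c k                         ≤⟨ ∨-least (trans (x≤x∨y b _) (x≤x∨y _ _))
                                                     (trans (c-monotone-inject₁ k≤i) (y≤x∨y _ _)) ⟩
        (b ∨ (c k ∧ d)) ∨ c (inject₁ i) ∎)

    c-leftModular : ∀ k → LeftModular L (c k)
    c-leftModular k b d (b≤d , _) = antisym
      (decidable-stable (_ ≤? _) λ lhs≰rhs →
        let j , j≤lhs , j-minimal = minimalNotBelow-below fin lhs≰rhs
        in no-minimalNotBelow-in-modularGap k j≤lhs j-minimal)
      (modular-≤ b≤d)

lemma3p20 : (L : Lattice 0ℓ 0ℓ 0ℓ) → Finite L → Extremal L →
              CongruenceUniform L →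
              ∀ x → InSpine L x → LeftModular L x
lemma3p20 L fin (n , n-isLength , #joinIrreducibles , _) cu x
          (n′ , n′-isLength , F , (length≡ , F-chain) , x∈F) =
  let k , x≈cₖ = ∈⇒chainAt L F length≡ x∈F
  in leftModular-resp L (Eq.sym x≈cₖ) (c-leftModular k)
  where
  open Lattice L using (module Eq)
  open Chain L fin (congruenceUniform⇒meetSemidistributive L cu)
    (≡.subst (HasCount L (JoinIrreducible L)) (isLength-unique L n-isLength n′-isLength) #joinIrreducibles)
    (chainAt L F length≡) (chainAt-increasing L F length≡ F-chain)
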